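{- Let $f:\mathbb{Z}_{\ge0}\to\mathbb{Z}_{\ge0}$ be nondecreasing with $G_f(\{y,z\})=y\oplus z$ for all $y,z\in\mathbb{Z}_{\ge0}$ with $y\le f(z)$. Let $a=d\cdot2^{i+1}+d_i2^i+e-1$ where $d,e,i\in\mathbb{Z}_{\ge0}$, $d_i\in\{0,1\}$, $e<2^i$ and $0<d_i2^i+e$. If $c\cdot2^{i+1}\le f(a)<c\cdot2^{i+1}+2^i$ for some $c\in\mathbb{Z}_{\ge0}$, then $f(a+1)<c\cdot2^{i+1}+2^i$.
   Context: $\oplus$ denotes nim-sum (bitwise XOR). Positions of the chocolate bar game $CB(f,y,z)$ are pairs $\{y,z\}$ with $y\le f(z)$ (bar with $z+1$ columns, column 0 bitter, column $i$ of height $\min(f(i),y)+1$). Moves: $move_f(\{y,z\})=\{\{v,z\}:v<y\}\cup\{\{\min(y,f(w)),w\}:w<z\}$. Grundy number: $G_f(\{y,z\})=\mathrm{mex}\{G_f(p):p\in move_f(\{y,z\})\}$, mex being the least nonnegative integer not in the set. -}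

module Defs where

open import Data.Nat using (ℕ; zero; suc; _+_; _*_; _≤_; _<_; _⊓_; _^_)
open import Data.Nat.Properties using (_≟_)
open import Data.Nat.DivMod using (_/_; _%_)
open import Data.Bool using (Bool; true; false; if_then_else_)
open import Data.List using (List; []; _∷_; _++_; map; length)
open import Relation.Nullary using (does)

-- Nim-sum (bitwise XOR) of natural numbers, by recursion on the binary digits.
-- Fuel argument k ≥ max(m,n) suffices (each step halves both numbers).
xorFuel : ℕ → ℕ → ℕ → ℕ
xorFuel zero m n = 0
xorFuel (suc k) m n =
  (if does (m % 2 ≟ n % 2) then 0 else 1) + 2 * xorFuel k (m / 2) (n / 2)

_⊕_ : ℕ → ℕ → ℕ
m ⊕ n = xorFuel (m + n) m n

infixl 6 _⊕_

elem : ℕ → List ℕ → Bool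
elem n [] = false
elem n (x ∷ xs) = if does (n ≟ x) then true else elem n xs

-- mex: least natural number not in the list (search from k upward; the
-- answer is at most the length of the list, so that much fuel suffices).
mexFrom : ℕ → ℕ → List ℕ → ℕ
mexFrom zero k xs = k
mexFrom (suc fuel) k xs = if elem k xs then mexFrom fuel (suc k) xs else k

mex : List ℕ → ℕ
mex xs = mexFrom (length xs) 0 xs

-- Grundy number G_f({y,z}) of the chocolate bar game CB(f,y,z).
-- move_f({y,z}) = {{v,z} : v < y} ∪ {{min(y,f(w)),w} : w < z}.
module _ (f : ℕ → ℕ) where

  mutual
    grundy : ℕ → ℕ → ℕ
    grundy y z = column z y

    column : ℕ → ℕ → ℕ
    column z y = mex (lowerY z y ++ lowerZ y z)

    lowerY : ℕ → ℕ → List ℕ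
    lowerY z zero = []
    lowerY z (suc y) = column z y ∷ lowerY z y

    lowerZ : ℕ → ℕ → List ℕ
    lowerZ y zero = []
    lowerZ y (suc w) = column w (y ⊓ f w) ∷ lowerZ y w

-- Say f jumps at b on level ℓ when ⌊f(b+1)/2^ℓ⌋ > ⌊f(b)/2^ℓ⌋. By strong induction on b, f never
-- jumps at b on a level ℓ with 2^(ℓ+1) ∤ b+1; the theorem is the case b = a, ℓ = i.
-- If f jumps at a, take the highest binary digit k where f(a) and f(a+1) differ, so that
-- ⌊f(a)/2^k⌋ = 2s and Y = (2s+1)·2^k satisfies f(w) < Y ≤ f(a+1) for all w ≤ a. The Grundy value
-- Y ⊕ (a+1) of {Y, a+1} then differs from the value f(w) ⊕ w of each option {f(w), w}.
-- If ⌊(a+1)/2^k⌋ is odd, comparing Y ⊕ (a+1) with f(a) ⊕ a digitwise shows that it is the value of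
-- {f(a), a} or of one of its options {f(w), w}: a contradiction.
-- If it is even, then 2^k ∤ a+1 because 2^(k+1) ∤ a+1, so clearing the last k digits of Y ⊕ (a+1)
-- gives a smaller value, which the mex forces to be some f(w) ⊕ w with w ≤ a. At the level L > k
-- where w and a+1 last differ, the induction hypothesis gives ⌊f(w)/2^L⌋ = ⌊f(a)/2^L⌋ = ⌊Y/2^L⌋,
-- and then digit L of f(w) ⊕ w disagrees with digit L of Y ⊕ (a+1).

module Submission where

open import Defs
open import Data.Nat using (ℕ; zero; suc; _+_; _*_; _∸_; _^_; _≤_; _<_)
open import Relation.Binary.PropositionalEquality using (_≡_)

open import Data.Bool using (Bool; true; false; if_then_else_; _xor_)
open import Data.Bool.Properties using (xor-comm; xor-assoc; xor-same; xor-identityʳ)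
open import Data.Nat using (NonZero; >-nonZero; _≡ᵇ_; _⊓_; pred; z≤n; s≤s; s≤s⁻¹)
open import Data.Nat.Properties
open import Data.Nat.DivMod
open import Data.Nat.Divisibility using (_∣_; divides; ∣-trans; n∣m*n; ∣m+n∣m⇒∣n; ∣⇒≤)
open import Data.Nat.Induction using (<-rec)
open import Data.Nat.Tactic.RingSolver using (solve-∀)
open import Data.Product using (∃; ∃₂; _×_; _,_; proj₁; proj₂)
open import Data.Sum using (_⊎_; inj₁; inj₂)
open import Data.Empty using (⊥; ⊥-elim)
open import Function using (case_of_)
open import Data.Unit using (tt)
open import Data.Fin as Fin using (Fin; toℕ)
open import Data.Fin.Properties using (toℕ<n; pigeonhole)
open import Data.List using (_∷_; _++_; map; length; lookup; downFrom)
open import Data.List.Membership.Propositional using (_∈_; _∉_)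
open import Data.List.Membership.Propositional.Properties using (∈-map⁺; ∈-map⁻; ∈-++⁺ʳ; ∈-++⁻; ∈-downFrom⁺; ∈-downFrom⁻)
open import Data.List.Relation.Unary.Any using (here; there; index)
open import Data.List.Relation.Unary.Any.Properties using (lookup-index)
open import Relation.Nullary using (does; yes; no; ¬_)
open import Relation.Binary.PropositionalEquality
  using (_≢_; refl; sym; trans; cong; cong₂; subst; subst₂; module ≡-Reasoning)

-- Division with remainder

[r+qn]/n≡q : ∀ {r n} q .{{_ : NonZero n}} → r < n → (r + q * n) / n ≡ q
[r+qn]/n≡q {r} {n} q r<n = begin
  (r + q * n) / n        ≡⟨ +-distrib-/ r (q * n) (subst (_< n) (sym remainders) r<n) ⟩
  r / n + q * n / n      ≡⟨ cong₂ _+_ (m<n⇒m/n≡0 r<n) (m*n/n≡m q n) ⟩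
  q                      ∎
  where
  open ≡-Reasoning
  remainders : r % n + q * n % n ≡ r
  remainders = trans (cong₂ _+_ (m<n⇒m%n≡m r<n) (m*n%n≡0 q n)) (+-identityʳ r)

[r+qn]%n≡r : ∀ {r n} q .{{_ : NonZero n}} → r < n → (r + q * n) % n ≡ r
[r+qn]%n≡r {r} {n} q r<n = trans ([m+kn]%n≡m%n r q n) (m<n⇒m%n≡m r<n)

m/n<o/n⇒m<o : ∀ {m o} n .{{_ : NonZero n}} → m / n < o / n → m < o
m/n<o/n⇒m<o {m} {o} n lt = ≰⇒> λ o≤m → <⇒≱ lt (/-monoˡ-≤ n o≤m)

m<[1+m/n]*n : ∀ m n .{{_ : NonZero n}} → m < suc (m / n) * n
m<[1+m/n]*n m n = begin-strict
  m                     ≡⟨ m≡m%n+[m/n]*n m n ⟩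
  m % n + m / n * n     <⟨ +-monoˡ-< (m / n * n) (m%n<n m n) ⟩
  n + m / n * n         ∎
  where open ≤-Reasoning

≤-by-/-% : ∀ {m o} n .{{_ : NonZero n}} → m / n ≡ o / n → m % n ≤ o % n → m ≤ o
≤-by-/-% {m} {o} n same-quotient rem≤ = begin
  m                     ≡⟨ m≡m%n+[m/n]*n m n ⟩
  m % n + m / n * n     ≡⟨ cong (λ q → m % n + q * n) same-quotient ⟩
  m % n + o / n * n     ≤⟨ +-monoˡ-≤ (o / n * n) rem≤ ⟩
  o % n + o / n * n     ≡⟨ m≡m%n+[m/n]*n o n ⟨
  o                     ∎
  where open ≤-Reasoning

pred-/-%-suc : ∀ {a r} n .{{_ : NonZero n}} → suc a % n ≡ suc r → a / n ≡ suc a / n × a % n ≡ r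
pred-/-%-suc {a} {r} n eq = trans (/-congˡ a≡) ([r+qn]/n≡q (suc a / n) r<n) , trans (%-congˡ a≡) ([r+qn]%n≡r (suc a / n) r<n)
  where
  a≡ : a ≡ r + suc a / n * n
  a≡ = suc-injective (trans (m≡m%n+[m/n]*n (suc a) n) (cong (_+ suc a / n * n) eq))
  r<n : r < n
  r<n = <-trans (n<1+n r) (subst (_< n) eq (m%n<n (suc a) n))

pred-/-%-zero : ∀ {a} n .{{_ : NonZero n}} → suc a % n ≡ 0 → suc (a / n) ≡ suc a / n × a % n ≡ pred n
pred-/-%-zero {a} n eq = sym (trans (/-congˡ 1+a≡) (m*n/n≡m (suc (a / n)) n)) , a%n≡
  where
  a%n≡ : a % n ≡ pred n
  a%n≡ = %-pred-≡0 eq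
  1+a≡ : suc a ≡ suc (a / n) * n
  1+a≡ = begin
    suc a                   ≡⟨ cong suc (m≡m%n+[m/n]*n a n) ⟩
    suc (a % n + a / n * n) ≡⟨ cong (λ r → suc r + a / n * n) a%n≡ ⟩
    suc (pred n) + a / n * n ≡⟨ cong (_+ a / n * n) (suc-pred n) ⟩
    n + a / n * n           ∎
    where open ≡-Reasoning

¬∣-inside-block : ∀ {w m n} d .{{_ : NonZero d}} → w < m → m ≤ n → w / d ≡ n / d → ¬ d ∣ m
¬∣-inside-block {w} {m} {n} d w<m m≤n same d∣m = <⇒≱ w<m (begin
  m              ≡⟨ m/n*n≡m d∣m ⟨
  m / d * d      ≤⟨ *-monoˡ-≤ d (subst (m / d ≤_) (sym same) (/-monoˡ-≤ d m≤n)) ⟩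
  w / d * d      ≤⟨ m/n*n≤m w d ⟩
  w              ∎)
  where open ≤-Reasoning

¬∣-nonzero-remainder : ∀ {r n} q → 0 < r → r < n → ¬ n ∣ q * n + r
¬∣-nonzero-remainder {r} {n} q 0<r r<n n∣ = <⇒≱ r<n (∣⇒≤ {{>-nonZero 0<r}} (∣m+n∣m⇒∣n n∣ (n∣m*n q)))

-- Powers of two

infixl 7 _/2^_ _%2^_

_/2^_ : ℕ → ℕ → ℕ
m /2^ k = _/_ m (2 ^ k) {{m^n≢0 2 k}}

_%2^_ : ℕ → ℕ → ℕ
m %2^ k = _%_ m (2 ^ k) {{m^n≢0 2 k}}

/2^-+ : ∀ m j k → m /2^ (j + k) ≡ m /2^ j /2^ k
/2^-+ m j k = trans (/-congʳ (^-distribˡ-+-* 2 j k)) (sym (m/n/o≡m/[n*o] m (2 ^ j) (2 ^ k)))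
  where instance
  _ = m^n≢0 2 j
  _ = m^n≢0 2 k
  _ = m^n≢0 2 (j + k)
  _ = m*n≢0 (2 ^ j) (2 ^ k)

/2^-suc : ∀ m k → m /2^ suc k ≡ m /2^ k / 2
/2^-suc m k = trans (cong (m /2^_) (+-comm 1 k)) (/2^-+ m k 1)

/2^-lift : ∀ k j {x y} → x /2^ k ≡ y /2^ k → x /2^ (k + j) ≡ y /2^ (k + j)
/2^-lift k j {x} {y} eq = trans (/2^-+ x k j) (trans (cong (_/2^ j) eq) (sym (/2^-+ y k j)))

n<2^n : ∀ n → n < 2 ^ n
n<2^n zero = s≤s z≤n
n<2^n (suc n) = begin-strict
  suc n               ≤⟨ n<2^n n ⟩
  2 ^ n               <⟨ m<m+n (2 ^ n) (m^n>0 2 n) ⟩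
  2 ^ n + 2 ^ n       ≡⟨ cong (2 ^ n +_) (+-identityʳ (2 ^ n)) ⟨
  2 ^ suc n           ∎
  where open ≤-Reasoning

m<2^[m+n] : ∀ m n → m < 2 ^ (m + n)
m<2^[m+n] m n = ≤-<-trans (m≤m+n m n) (n<2^n (m + n))

n<2^[m+n] : ∀ m n → n < 2 ^ (m + n)
n<2^[m+n] m n = ≤-<-trans (m≤n+m n m) (n<2^n (m + n))

2^-∣-mono : ∀ {ℓ k} → ℓ ≤ k → 2 ^ ℓ ∣ 2 ^ k
2^-∣-mono {ℓ} {k} ℓ≤k = divides (2 ^ (k ∸ ℓ)) (begin
  2 ^ k                  ≡⟨ cong (2 ^_) (m+[n∸m]≡n ℓ≤k) ⟨
  2 ^ (ℓ + (k ∸ ℓ))      ≡⟨ ^-distribˡ-+-* 2 ℓ (k ∸ ℓ) ⟩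
  2 ^ ℓ * 2 ^ (k ∸ ℓ)    ≡⟨ *-comm (2 ^ ℓ) (2 ^ (k ∸ ℓ)) ⟩
  2 ^ (k ∸ ℓ) * 2 ^ ℓ    ∎)
  where open ≡-Reasoning

-- Binary digits and nim-sum

bit : Bool → ℕ
bit false = 0
bit true  = 1

bit<2 : ∀ b → bit b < 2
bit<2 false = s≤s z≤n
bit<2 true  = s≤s (s≤s z≤n)

[b+2h]/2≡h : ∀ b h → (bit b + h * 2) / 2 ≡ h
[b+2h]/2≡h b h = [r+qn]/n≡q h (bit<2 b)

[b+2h]%2≡b : ∀ b h → (bit b + h * 2) % 2 ≡ bit b
[b+2h]%2≡b b h = [r+qn]%n≡r h (bit<2 b)

data Bits : ℕ → Set where
  _∷ᵇ_ : ∀ b h → Bits (bit b + h * 2)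

bits : ∀ n → Bits n
bits zero = false ∷ᵇ 0
bits (suc n) with bits n
... | false ∷ᵇ h = true ∷ᵇ h
... | true  ∷ᵇ h = false ∷ᵇ suc h

even-or-odd : ∀ n → (∃ λ h → n ≡ h * 2) ⊎ (∃ λ h → n ≡ 1 + h * 2)
even-or-odd n with bits n
... | false ∷ᵇ h = inj₁ (h , refl)
... | true  ∷ᵇ h = inj₂ (h , refl)

m*2≢1+n*2 : ∀ m n → m * 2 ≢ 1 + n * 2
m*2≢1+n*2 m n eq = even≢odd m n (trans (*-comm 2 m) (trans eq (cong suc (*-comm n 2))))

data Digits : ℕ → ℕ → Set where
  []  : Digits zero 0
  _∷_ : ∀ b {k h} → Digits k h → Digits (suc k) (bit b + h * 2)

digits : ∀ k {x} → x < 2 ^ k → Digits k x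
digits zero {zero} _ = []
digits zero {suc _} (s≤s ())
digits (suc k) {x} x<2^[1+k] with bits x
... | b ∷ᵇ h = b ∷ digits k (*-cancelʳ-< 2 h (2 ^ k) (begin-strict
  h * 2            ≤⟨ m≤n+m (h * 2) (bit b) ⟩
  bit b + h * 2    <⟨ x<2^[1+k] ⟩
  2 * 2 ^ k        ≡⟨ *-comm 2 (2 ^ k) ⟩
  2 ^ k * 2        ∎))
  where open ≤-Reasoning

Digits⇒< : ∀ {k x} → Digits k x → x < 2 ^ k
Digits⇒< [] = s≤s z≤n
Digits⇒< {suc k} (_∷_ b {h = h} d) = begin-strict
  bit b + h * 2   <⟨ +-monoˡ-< (h * 2) (bit<2 b) ⟩
  suc h * 2       ≤⟨ *-monoˡ-≤ 2 (Digits⇒< d) ⟩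
  2 ^ k * 2       ≡⟨ *-comm (2 ^ k) 2 ⟩
  2 ^ suc k       ∎
  where open ≤-Reasoning

xorBit : ℕ → ℕ → ℕ
xorBit m n = if does (m ≟ n) then 0 else 1

xorBit-bit : ∀ b c → xorBit (bit b) (bit c) ≡ bit (b xor c)
xorBit-bit false false = refl
xorBit-bit false true  = refl
xorBit-bit true  false = refl
xorBit-bit true  true  = refl

half-≤ : ∀ {x k} → 2 * x ≤ suc k → x ≤ k
half-≤ {zero}  _          = z≤n
half-≤ {suc x} (s≤s 2x≤k) = ≤-trans (m≤m+n (suc x) 0) (≤-trans (m≤n+m (suc x + 0) x) 2x≤k)

halves-≤ : ∀ {m n k} → m + n ≤ suc k → m / 2 + n / 2 ≤ k
halves-≤ {m} {n} m+n≤1+k = half-≤ (begin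
  2 * (m / 2 + n / 2)         ≡⟨ *-distribˡ-+ 2 (m / 2) (n / 2) ⟩
  2 * (m / 2) + 2 * (n / 2)   ≡⟨ cong₂ _+_ (*-comm 2 (m / 2)) (*-comm 2 (n / 2)) ⟩
  m / 2 * 2 + n / 2 * 2       ≤⟨ +-mono-≤ (m/n*n≤m m 2) (m/n*n≤m n 2) ⟩
  m + n                       ≤⟨ m+n≤1+k ⟩
  suc _                       ∎)
  where open ≤-Reasoning

xorFuel-irrelevant : ∀ {k k′} m n → m + n ≤ k → m + n ≤ k′ → xorFuel k m n ≡ xorFuel k′ m n
xorFuel-irrelevant {zero}  {zero}   _ _ _ _ = refl
xorFuel-irrelevant {zero}  {suc k′} zero zero _ _ = cong (2 *_) (xorFuel-irrelevant {zero} {k′} 0 0 z≤n z≤n)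
xorFuel-irrelevant {suc k} {zero}   zero zero _ _ = cong (2 *_) (xorFuel-irrelevant {k} {zero} 0 0 z≤n z≤n)
xorFuel-irrelevant {suc k} {suc k′} m n ≤1+k ≤1+k′ =
  cong (λ t → xorBit (m % 2) (n % 2) + 2 * t) (xorFuel-irrelevant (m / 2) (n / 2) (halves-≤ {m} ≤1+k) (halves-≤ {m} ≤1+k′))

⊕-unfold : ∀ m n → m ⊕ n ≡ xorBit (m % 2) (n % 2) + 2 * (m / 2 ⊕ n / 2)
⊕-unfold m n = trans (xorFuel-irrelevant m n ≤-refl (n≤1+n (m + n)))
  (cong (λ t → xorBit (m % 2) (n % 2) + 2 * t)
        (xorFuel-irrelevant (m / 2) (n / 2) (+-mono-≤ (m/n≤m m 2) (m/n≤m n 2)) ≤-refl))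

⊕-bits : ∀ b c h h′ → (bit b + h * 2) ⊕ (bit c + h′ * 2) ≡ bit (b xor c) + (h ⊕ h′) * 2
⊕-bits b c h h′ = trans (⊕-unfold (bit b + h * 2) (bit c + h′ * 2))
  (cong₂ _+_ (trans (cong₂ xorBit ([b+2h]%2≡b b h) ([b+2h]%2≡b c h′)) (xorBit-bit b c))
             (trans (cong₂ (λ x y → 2 * (x ⊕ y)) ([b+2h]/2≡h b h) ([b+2h]/2≡h c h′)) (*-comm 2 (h ⊕ h′))))

⊕-digits : ∀ {k x y} → Digits k x → Digits k y → Digits k (x ⊕ y)
⊕-digits [] [] = []
⊕-digits (_∷_ b {h = h} dx) (_∷_ c {h = h′} dy) =
  subst (Digits _) (sym (⊕-bits b c h h′)) ((b xor c) ∷ ⊕-digits dx dy)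

⊕-identityʳ-digits : ∀ {k x} → Digits k x → x ⊕ 0 ≡ x
⊕-identityʳ-digits [] = refl
⊕-identityʳ-digits (_∷_ b {h = h} dx) = trans (⊕-bits b false h 0)
  (cong₂ (λ β t → bit β + t * 2) (xor-identityʳ b) (⊕-identityʳ-digits dx))

⊕-comm-digits : ∀ {k x y} → Digits k x → Digits k y → x ⊕ y ≡ y ⊕ x
⊕-comm-digits [] [] = refl
⊕-comm-digits (_∷_ b {h = h} dx) (_∷_ c {h = h′} dy) = begin
  (bit b + h * 2) ⊕ (bit c + h′ * 2)   ≡⟨ ⊕-bits b c h h′ ⟩
  bit (b xor c) + (h ⊕ h′) * 2         ≡⟨ cong₂ (λ β t → bit β + t * 2) (xor-comm b c) (⊕-comm-digits dx dy) ⟩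
  bit (c xor b) + (h′ ⊕ h) * 2         ≡⟨ ⊕-bits c b h′ h ⟨
  (bit c + h′ * 2) ⊕ (bit b + h * 2)   ∎
  where open ≡-Reasoning

⊕-cancelʳ-digits : ∀ {k x y} → Digits k x → Digits k y → (x ⊕ y) ⊕ y ≡ x
⊕-cancelʳ-digits [] [] = refl
⊕-cancelʳ-digits (_∷_ b {h = h} dx) (_∷_ c {h = h′} dy) = begin
  ((bit b + h * 2) ⊕ (bit c + h′ * 2)) ⊕ (bit c + h′ * 2)   ≡⟨ cong (_⊕ (bit c + h′ * 2)) (⊕-bits b c h h′) ⟩
  (bit (b xor c) + (h ⊕ h′) * 2) ⊕ (bit c + h′ * 2)         ≡⟨ ⊕-bits (b xor c) c (h ⊕ h′) h′ ⟩
  bit ((b xor c) xor c) + ((h ⊕ h′) ⊕ h′) * 2               ≡⟨ cong₂ (λ β t → bit β + t * 2) b⊻c⊻c≡b (⊕-cancelʳ-digits dx dy) ⟩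
  bit b + h * 2                                             ∎
  where
  open ≡-Reasoning
  b⊻c⊻c≡b : (b xor c) xor c ≡ b
  b⊻c⊻c≡b = trans (xor-assoc b c c) (trans (cong (b xor_) (xor-same c)) (xor-identityʳ b))

⊕-split-digits : ∀ {k r r′} q q′ → Digits k r → Digits k r′ →
                 (r + q * 2 ^ k) ⊕ (r′ + q′ * 2 ^ k) ≡ r ⊕ r′ + (q ⊕ q′) * 2 ^ k
⊕-split-digits q q′ [] [] = trans (cong₂ _⊕_ (*-identityʳ q) (*-identityʳ q′)) (sym (*-identityʳ (q ⊕ q′)))
⊕-split-digits {suc k} q q′ (_∷_ b {h = h} dr) (_∷_ c {h = h′} dr′) = begin
  (bit b + h * 2 + q * 2 ^ suc k) ⊕ (bit c + h′ * 2 + q′ * 2 ^ suc k)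
    ≡⟨ cong₂ _⊕_ (regroup (bit b) h q (2 ^ k)) (regroup (bit c) h′ q′ (2 ^ k)) ⟩
  (bit b + (h + q * 2 ^ k) * 2) ⊕ (bit c + (h′ + q′ * 2 ^ k) * 2)
    ≡⟨ ⊕-bits b c (h + q * 2 ^ k) (h′ + q′ * 2 ^ k) ⟩
  bit (b xor c) + ((h + q * 2 ^ k) ⊕ (h′ + q′ * 2 ^ k)) * 2
    ≡⟨ cong (λ t → bit (b xor c) + t * 2) (⊕-split-digits q q′ dr dr′) ⟩
  bit (b xor c) + (h ⊕ h′ + (q ⊕ q′) * 2 ^ k) * 2
    ≡⟨ regroup (bit (b xor c)) (h ⊕ h′) (q ⊕ q′) (2 ^ k) ⟨
  bit (b xor c) + (h ⊕ h′) * 2 + (q ⊕ q′) * 2 ^ suc k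
    ≡⟨ cong (_+ (q ⊕ q′) * 2 ^ suc k) (⊕-bits b c h h′) ⟨
  (bit b + h * 2) ⊕ (bit c + h′ * 2) + (q ⊕ q′) * 2 ^ suc k
    ∎
  where
  open ≡-Reasoning
  regroup : ∀ β h q n → β + h * 2 + q * (2 * n) ≡ β + (h + q * n) * 2
  regroup = solve-∀

⊕-comm : ∀ x y → x ⊕ y ≡ y ⊕ x
⊕-comm x y = ⊕-comm-digits (digits (x + y) (m<2^[m+n] x y)) (digits (x + y) (n<2^[m+n] x y))

⊕-cancelʳ : ∀ x y → (x ⊕ y) ⊕ y ≡ x
⊕-cancelʳ x y = ⊕-cancelʳ-digits (digits (x + y) (m<2^[m+n] x y)) (digits (x + y) (n<2^[m+n] x y))

⊕-identityʳ : ∀ x → x ⊕ 0 ≡ x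
⊕-identityʳ x = ⊕-identityʳ-digits (digits x (n<2^n x))

⊕-identityˡ : ∀ x → 0 ⊕ x ≡ x
⊕-identityˡ x = trans (⊕-comm 0 x) (⊕-identityʳ x)

⊕-injectiveˡ : ∀ {x y} z → x ⊕ z ≡ y ⊕ z → x ≡ y
⊕-injectiveˡ {x} {y} z eq = begin
  x             ≡⟨ ⊕-cancelʳ x z ⟨
  (x ⊕ z) ⊕ z   ≡⟨ cong (_⊕ z) eq ⟩
  (y ⊕ z) ⊕ z   ≡⟨ ⊕-cancelʳ y z ⟩
  y             ∎
  where open ≡-Reasoning

⊕-injectiveʳ : ∀ {x y} z → z ⊕ x ≡ z ⊕ y → x ≡ y
⊕-injectiveʳ {x} {y} z eq = ⊕-injectiveˡ z (trans (⊕-comm x z) (trans eq (⊕-comm z y)))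

⊕-< : ∀ k {x y} → x < 2 ^ k → y < 2 ^ k → x ⊕ y < 2 ^ k
⊕-< k x< y< = Digits⇒< (⊕-digits (digits k x<) (digits k y<))

⊕-divMod : ∀ k x y → x ⊕ y ≡ x %2^ k ⊕ y %2^ k + (x /2^ k ⊕ y /2^ k) * 2 ^ k
⊕-divMod k x y = trans (cong₂ _⊕_ (m≡m%n+[m/n]*n x (2 ^ k)) (m≡m%n+[m/n]*n y (2 ^ k)))
                       (⊕-split-digits (x /2^ k) (y /2^ k) (digits k (m%n<n x (2 ^ k))) (digits k (m%n<n y (2 ^ k))))
  where instance _ = m^n≢0 2 k

/2^-⊕ : ∀ k x y → (x ⊕ y) /2^ k ≡ x /2^ k ⊕ y /2^ k
/2^-⊕ k x y = trans (/-congˡ (⊕-divMod k x y))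
  ([r+qn]/n≡q (x /2^ k ⊕ y /2^ k) (⊕-< k (m%n<n x (2 ^ k)) (m%n<n y (2 ^ k))))
  where instance _ = m^n≢0 2 k

%2^-⊕ : ∀ k x y → (x ⊕ y) %2^ k ≡ x %2^ k ⊕ y %2^ k
%2^-⊕ k x y = trans (%-congˡ (⊕-divMod k x y))
  ([r+qn]%n≡r (x /2^ k ⊕ y /2^ k) (⊕-< k (m%n<n x (2 ^ k)) (m%n<n y (2 ^ k))))
  where instance _ = m^n≢0 2 k

highest-differing-bit-digits : ∀ {k x y} → Digits k x → Digits k y → x < y →
                               ∃₂ λ j s → x /2^ j ≡ s * 2 × y /2^ j ≡ 1 + s * 2
highest-differing-bit-digits [] [] ()
highest-differing-bit-digits (_∷_ b {h = h} dx) (_∷_ c {h = h′} dy) x<y with h ≟ h′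
... | yes refl = lowest b c (+-cancelʳ-< (h * 2) (bit b) (bit c) x<y)
  where
  lowest : ∀ b c → bit b < bit c → ∃₂ λ j s → (bit b + h * 2) /2^ j ≡ s * 2 × (bit c + h * 2) /2^ j ≡ 1 + s * 2
  lowest false true _ = 0 , h , n/1≡n (h * 2) , n/1≡n (1 + h * 2)
  lowest true  true (s≤s ())
... | no h≢h′ with highest-differing-bit-digits dx dy (≤∧≢⇒< h≤h′ h≢h′)
  where
  h≤h′ : h ≤ h′
  h≤h′ = subst₂ _≤_ ([b+2h]/2≡h b h) ([b+2h]/2≡h c h′) (/-monoˡ-≤ 2 (<⇒≤ x<y))
...   | j , s , hj , h′j = suc j , s , shift b h hj , shift c h′ h′j
  where
  shift : ∀ b h {t} → h /2^ j ≡ t → (bit b + h * 2) /2^ suc j ≡ t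
  shift b h eq = trans (/2^-+ (bit b + h * 2) 1 j) (trans (cong (_/2^ j) ([b+2h]/2≡h b h)) eq)

highest-differing-bit : ∀ {x y} → x < y → ∃₂ λ j s → x /2^ j ≡ s * 2 × y /2^ j ≡ 1 + s * 2
highest-differing-bit {x} {y} x<y =
  highest-differing-bit-digits (digits y (<-trans x<y (n<2^n y))) (digits y (n<2^n y)) x<y

-- Minimal excludant

-- `does (n ≟ x)` computes to `n ≡ᵇ x`, so that is the term to abstract over.
elem⇒∈ : ∀ {n} xs → elem n xs ≡ true → n ∈ xs
elem⇒∈ {n} (x ∷ xs) e with n ≡ᵇ x | ≡ᵇ⇒≡ n x
... | true  | n≡x = here (n≡x tt)
... | false | _   = there (elem⇒∈ xs e)

∈⇒elem : ∀ {n xs} → n ∈ xs → elem n xs ≡ true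
∈⇒elem {n} {x ∷ xs} n∈ with n ≡ᵇ x | ≡⇒≡ᵇ n x | n∈
... | true  | _ | _ = refl
... | false | n≡x⇒⊥ | here n≡x = ⊥-elim (n≡x⇒⊥ n≡x)
... | false | _ | there n∈xs = ∈⇒elem n∈xs

elem-false⇒∉ : ∀ {n} xs → elem n xs ≡ false → n ∉ xs
elem-false⇒∉ xs e n∈ with trans (sym e) (∈⇒elem n∈)
... | ()

all-≤-∈⇒<length : ∀ {n xs} → (∀ {u} → u ≤ n → u ∈ xs) → n < length xs
all-≤-∈⇒<length {n} {xs} all∈ = ≰⇒> λ length≤n → collision (pigeonhole (s≤s length≤n) position)
  where
  member : (i : Fin (suc n)) → toℕ i ∈ xs
  member i = all∈ (s≤s⁻¹ (toℕ<n i))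
  position : Fin (suc n) → Fin (length xs)
  position i = index (member i)
  lookup-position : ∀ i → toℕ i ≡ lookup xs (position i)
  lookup-position i = lookup-index (member i)
  collision : ¬ ∃₂ λ i j → i Fin.< j × position i ≡ position j
  collision (i , j , i<j , same) =
    <-irrefl (trans (lookup-position i) (trans (cong (lookup xs) same) (sym (lookup-position j)))) i<j

mexFrom-minimal : ∀ fuel k xs {u} → k ≤ u → u < mexFrom fuel k xs → u ∈ xs
mexFrom-minimal zero k xs k≤u u<k = ⊥-elim (<⇒≱ u<k k≤u)
mexFrom-minimal (suc fuel) k xs {u} k≤u u< with elem k xs in k∈?
... | false = ⊥-elim (<⇒≱ u< k≤u)
... | true with k ≟ u
...   | yes refl = elem⇒∈ xs k∈?
...   | no k≢u = mexFrom-minimal fuel (suc k) xs (≤∧≢⇒< k≤u k≢u) u<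

mex-minimal : ∀ xs {u} → u < mex xs → u ∈ xs
mex-minimal xs = mexFrom-minimal (length xs) 0 xs z≤n

mexFrom-∉-or-exhausted : ∀ fuel k xs → mexFrom fuel k xs ∉ xs ⊎ mexFrom fuel k xs ≡ k + fuel
mexFrom-∉-or-exhausted zero k xs = inj₂ (sym (+-identityʳ k))
mexFrom-∉-or-exhausted (suc fuel) k xs with elem k xs in k∈?
... | false = inj₁ (elem-false⇒∉ xs k∈?)
... | true with mexFrom-∉-or-exhausted fuel (suc k) xs
...   | inj₁ ∉xs = inj₁ ∉xs
...   | inj₂ eq = inj₂ (trans eq (sym (+-suc k fuel)))

mex-∉ : ∀ xs → mex xs ∉ xs
mex-∉ xs mex∈xs with mexFrom-∉-or-exhausted (length xs) 0 xs
... | inj₁ mex∉xs = mex∉xs mex∈xs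
... | inj₂ mex≡length = <-irrefl refl (all-≤-∈⇒<length below-mex)
  where
  below-mex : ∀ {u} → u ≤ length xs → u ∈ xs
  below-mex {u} u≤ with m≤n⇒m<n∨m≡n u≤
  ... | inj₁ u< = mex-minimal xs (subst (u <_) (sym mex≡length) u<)
  ... | inj₂ refl = subst (_∈ xs) mex≡length mex∈xs

-- Options in the chocolate bar game

module _ (f : ℕ → ℕ) where

  lowerY-downFrom : ∀ z y → lowerY f z y ≡ map (column f z) (downFrom y)
  lowerY-downFrom z zero    = refl
  lowerY-downFrom z (suc y) = cong (column f z y ∷_) (lowerY-downFrom z y)

  lowerZ-downFrom : ∀ y z → lowerZ f y z ≡ map (λ w → column f w (y ⊓ f w)) (downFrom z)
  lowerZ-downFrom y zero    = refl
  lowerZ-downFrom y (suc z) = cong (column f z (y ⊓ f z) ∷_) (lowerZ-downFrom y z)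

  below-grundy-is-option : ∀ {y z u} → u < grundy f y z →
                           (∃ λ v → v < y × u ≡ grundy f v z) ⊎ (∃ λ w → w < z × u ≡ grundy f (y ⊓ f w) w)
  below-grundy-is-option {y} {z} u< with ∈-++⁻ (lowerY f z y) (mex-minimal (lowerY f z y ++ lowerZ f y z) u<)
  ... | inj₁ u∈lowerY with v , v∈ , u≡ ← ∈-map⁻ (column f z) (subst (_ ∈_) (lowerY-downFrom z y) u∈lowerY) =
    inj₁ (v , ∈-downFrom⁻ v∈ , u≡)
  ... | inj₂ u∈lowerZ with w , w∈ , u≡ ← ∈-map⁻ (λ w → column f w (y ⊓ f w)) (subst (_ ∈_) (lowerZ-downFrom y z) u∈lowerZ) =
    inj₂ (w , ∈-downFrom⁻ w∈ , u≡)

  grundy-≢-option : ∀ {y z w} → w < z → grundy f (y ⊓ f w) w ≢ grundy f y z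
  grundy-≢-option {y} {z} {w} w<z same = mex-∉ (lowerY f z y ++ lowerZ f y z)
    (subst (_∈ lowerY f z y ++ lowerZ f y z) same
      (∈-++⁺ʳ (lowerY f z y) (subst (_ ∈_) (sym (lowerZ-downFrom y z)) (∈-map⁺ _ (∈-downFrom⁺ w<z)))))

module _ (f : ℕ → ℕ) (grundy-⊕ : ∀ y z → y ≤ f z → grundy f y z ≡ y ⊕ z) where

  full-column-value-below : ∀ {y z u} → y ≤ f z → (∀ {w} → w < z → f w ≤ y) →
                            u < y ⊕ z → y ≤ u ⊕ z → ∃ λ w → w < z × u ≡ f w ⊕ w
  full-column-value-below {y} {z} {u} y≤fz lower≤y u< y≤u⊕z
    with below-grundy-is-option f (subst (u <_) (sym (grundy-⊕ y z y≤fz)) u<)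
  ... | inj₁ (v , v<y , u≡) = ⊥-elim (<⇒≱ v<y (subst (y ≤_) u⊕z≡v y≤u⊕z))
    where
    u⊕z≡v : u ⊕ z ≡ v
    u⊕z≡v = trans (cong (_⊕ z) (trans u≡ (grundy-⊕ v z (≤-trans (<⇒≤ v<y) y≤fz)))) (⊕-cancelʳ v z)
  ... | inj₂ (w , w<z , u≡) = w , w<z , trans u≡ (trans (cong (λ t → grundy f t w) (m≥n⇒m⊓n≡n (lower≤y w<z)))
                                                        (grundy-⊕ (f w) w ≤-refl))

  full-column-value-≢ : ∀ {y z w} → y ≤ f z → w < z → f w ≤ y → f w ⊕ w ≢ y ⊕ z
  full-column-value-≢ {y} {z} {w} y≤fz w<z fw≤y same = grundy-≢-option f {y} w<z (begin
    grundy f (y ⊓ f w) w   ≡⟨ cong (λ t → grundy f t w) (m≥n⇒m⊓n≡n fw≤y) ⟩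
    grundy f (f w) w       ≡⟨ grundy-⊕ (f w) w ≤-refl ⟩
    f w ⊕ w                ≡⟨ same ⟩
    y ⊕ z                  ≡⟨ grundy-⊕ y z y≤fz ⟨
    grundy f y z           ∎)
    where open ≡-Reasoning

-- Jumps

antitone-from-steps : ∀ (g : ℕ → ℕ) {w z} → w ≤ z → (∀ {b} → w ≤ b → b < z → g (suc b) ≤ g b) → g z ≤ g w
antitone-from-steps g {z = zero} z≤n _ = ≤-refl
antitone-from-steps g {w} {suc z} w≤1+z step with m≤n⇒m<n∨m≡n w≤1+z
... | inj₂ refl = ≤-refl
... | inj₁ (s≤s w≤z) = ≤-trans (step w≤z ≤-refl) (antitone-from-steps g w≤z λ w≤b b<z → step w≤b (m<n⇒m<1+n b<z))

module _ (f : ℕ → ℕ) (f-mono : ∀ {m n} → m ≤ n → f m ≤ f n)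
         (grundy-⊕ : ∀ y z → y ≤ f z → grundy f y z ≡ y ⊕ z) where

  NoJumpAt : ℕ → Set
  NoJumpAt b = ∀ ℓ → ¬ 2 ^ suc ℓ ∣ suc b → f (suc b) /2^ ℓ ≤ f b /2^ ℓ

  NoJumpBelow : ℕ → Set
  NoJumpBelow a = ∀ {b} → b < a → NoJumpAt b

  block-constant : ∀ {a} → NoJumpBelow a → ∀ L {w} → w ≤ a →
                   w /2^ suc L ≡ suc a /2^ suc L → f w /2^ L ≡ f a /2^ L
  block-constant {a} IH L {w} w≤a same-block =
    ≤-antisym (/-monoˡ-≤ (2 ^ L) (f-mono w≤a)) (antitone-from-steps (λ b → f b /2^ L) w≤a step)
    where
    instance
      _ = m^n≢0 2 L
      _ = m^n≢0 2 (suc L)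
    step : ∀ {b} → w ≤ b → b < a → f (suc b) /2^ L ≤ f b /2^ L
    step w≤b b<a = IH b<a L (¬∣-inside-block (2 ^ suc L) (s≤s w≤b) (m≤n⇒m≤1+n b<a) same-block)

  module Jump (a k s : ℕ) (fa/ : f a /2^ k ≡ s * 2) (fA/ : f (suc a) /2^ k ≡ 1 + s * 2) where

    private instance _ = m^n≢0 2 k

    Y : ℕ
    Y = (1 + s * 2) * 2 ^ k

    Y/ : Y /2^ k ≡ 1 + s * 2
    Y/ = m*n/n≡m (1 + s * 2) (2 ^ k)

    Y% : Y %2^ k ≡ 0
    Y% = m*n%n≡0 (1 + s * 2) (2 ^ k)

    Y≤fA : Y ≤ f (suc a)
    Y≤fA = subst (λ q → q * 2 ^ k ≤ f (suc a)) fA/ (m/n*n≤m (f (suc a)) (2 ^ k))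

    f<Y : ∀ {w} → w < suc a → f w < Y
    f<Y w<A = ≤-<-trans (f-mono (s≤s⁻¹ w<A)) (subst (λ q → f a < suc q * 2 ^ k) fa/ (m<[1+m/n]*n (f a) (2 ^ k)))

    YA/ : (Y ⊕ suc a) /2^ k ≡ (1 + s * 2) ⊕ suc a /2^ k
    YA/ = trans (/2^-⊕ k Y (suc a)) (cong (_⊕ suc a /2^ k) Y/)

    YA% : (Y ⊕ suc a) %2^ k ≡ suc a %2^ k
    YA% = trans (%2^-⊕ k Y (suc a)) (trans (cong (_⊕ suc a %2^ k) Y%) (⊕-identityˡ _))

    module Odd (h : ℕ) (A/ : suc a /2^ k ≡ 1 + h * 2) where

      u : ℕ
      u = Y ⊕ suc a

      u/ : u /2^ k ≡ (s ⊕ h) * 2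
      u/ = trans YA/ (trans (cong ((1 + s * 2) ⊕_) A/) (⊕-bits true true s h))

      bounds-without-borrow : ∀ {r} → suc a %2^ k ≡ suc r → u ≤ f a ⊕ a × f a ≤ u ⊕ a
      bounds-without-borrow A% with a/ , _ ← pred-/-%-suc (2 ^ k) A% =
        <⇒≤ (m/n<o/n⇒m<o (2 ^ k) (begin-strict
          u /2^ k                  ≡⟨ u/ ⟩
          (s ⊕ h) * 2              <⟨ n<1+n _ ⟩
          1 + (s ⊕ h) * 2          ≡⟨ ⊕-bits false true s h ⟨
          s * 2 ⊕ (1 + h * 2)      ≡⟨ cong₂ _⊕_ fa/ (trans a/ A/) ⟨
          f a /2^ k ⊕ a /2^ k      ≡⟨ /2^-⊕ k (f a) a ⟨
          (f a ⊕ a) /2^ k          ∎)) ,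
        <⇒≤ (m/n<o/n⇒m<o (2 ^ k) (begin-strict
          f a /2^ k                                 ≡⟨ fa/ ⟩
          s * 2                                     <⟨ n<1+n _ ⟩
          1 + s * 2                                 ≡⟨ ⊕-cancelʳ (1 + s * 2) (suc a /2^ k) ⟨
          (1 + s * 2) ⊕ suc a /2^ k ⊕ suc a /2^ k   ≡⟨ cong₂ _⊕_ YA/ a/ ⟨
          u /2^ k ⊕ a /2^ k                         ≡⟨ /2^-⊕ k u a ⟨
          (u ⊕ a) /2^ k                             ∎))
        where open ≤-Reasoning

      bounds-with-borrow : suc a %2^ k ≡ 0 → u ≤ f a ⊕ a × f a ≤ u ⊕ a
      bounds-with-borrow A% with 1+a/ , a% ← pred-/-%-zero (2 ^ k) A% =
        ≤-by-/-% (2 ^ k) (begin-equality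
          u /2^ k                  ≡⟨ u/ ⟩
          (s ⊕ h) * 2              ≡⟨ ⊕-bits false false s h ⟨
          s * 2 ⊕ h * 2            ≡⟨ cong₂ _⊕_ fa/ a/ ⟨
          f a /2^ k ⊕ a /2^ k      ≡⟨ /2^-⊕ k (f a) a ⟨
          (f a ⊕ a) /2^ k          ∎)
          (subst (_≤ (f a ⊕ a) %2^ k) (sym (trans YA% A%)) z≤n) ,
        ≤-by-/-% (2 ^ k) (begin-equality
          f a /2^ k                ≡⟨ fa/ ⟩
          s * 2                    ≡⟨ cong (_* 2) (⊕-cancelʳ s h) ⟨
          (s ⊕ h ⊕ h) * 2          ≡⟨ ⊕-bits false false (s ⊕ h) h ⟨
          (s ⊕ h) * 2 ⊕ h * 2      ≡⟨ cong₂ _⊕_ u/ a/ ⟨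
          u /2^ k ⊕ a /2^ k        ≡⟨ /2^-⊕ k u a ⟨
          (u ⊕ a) /2^ k            ∎)
          (begin
          f a %2^ k                ≤⟨ <⇒≤pred (m%n<n (f a) (2 ^ k)) ⟩
          pred (2 ^ k)             ≡⟨ ⊕-identityˡ _ ⟨
          0 ⊕ pred (2 ^ k)         ≡⟨ cong₂ _⊕_ (trans YA% A%) a% ⟨
          u %2^ k ⊕ a %2^ k        ≡⟨ %2^-⊕ k u a ⟨
          (u ⊕ a) %2^ k            ∎)
        where
        open ≤-Reasoning
        a/ : a /2^ k ≡ h * 2
        a/ = suc-injective (trans 1+a/ A/)

      bounds : u ≤ f a ⊕ a × f a ≤ u ⊕ a
      bounds with suc a %2^ k in A%
      ... | zero  = bounds-with-borrow A%
      ... | suc _ = bounds-without-borrow A%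

      reachable : ∃ λ w → w ≤ a × u ≡ f w ⊕ w
      reachable with m≤n⇒m<n∨m≡n (proj₁ bounds)
      ... | inj₂ u≡ = a , ≤-refl , u≡
      ... | inj₁ u< with w , w<a , u≡ ← full-column-value-below f grundy-⊕ ≤-refl (λ w<a → f-mono (<⇒≤ w<a)) u< (proj₂ bounds) =
        w , <⇒≤ w<a , u≡

      impossible : ⊥
      impossible with w , w≤a , u≡ ← reachable =
        full-column-value-≢ f grundy-⊕ Y≤fA (s≤s w≤a) (<⇒≤ (f<Y (s≤s w≤a))) (sym u≡)

    differing-level-impossible : NoJumpBelow a → ∀ {w} → w < suc a → ∀ j t →
                                 w /2^ (k + suc j) ≡ t * 2 → suc a /2^ (k + suc j) ≡ 1 + t * 2 →
                                 (f w ⊕ w) /2^ k ≡ (Y ⊕ suc a) /2^ k → ⊥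
    differing-level-impossible IH {w} w<A j t w/L A/L same/k = m*2≢1+n*2 t t (⊕-injectiveʳ (Y /2^ L) (begin
      Y /2^ L ⊕ t * 2              ≡⟨ cong₂ _⊕_ (trans fw≡fa fa≡Y) w/L ⟨
      f w /2^ L ⊕ w /2^ L          ≡⟨ /2^-⊕ L (f w) w ⟨
      (f w ⊕ w) /2^ L              ≡⟨ /2^-lift k (suc j) same/k ⟩
      (Y ⊕ suc a) /2^ L            ≡⟨ /2^-⊕ L Y (suc a) ⟩
      Y /2^ L ⊕ suc a /2^ L        ≡⟨ cong (Y /2^ L ⊕_) A/L ⟩
      Y /2^ L ⊕ (1 + t * 2)        ∎))
      where
      open ≡-Reasoning
      L = k + suc j
      halve : ∀ i x b {q} → x /2^ i ≡ bit b + q * 2 → x /2^ suc i ≡ q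
      halve i x b {q} eq = trans (/2^-suc x i) (trans (cong (_/ 2) eq) ([b+2h]/2≡h b q))
      fw≡fa : f w /2^ L ≡ f a /2^ L
      fw≡fa = block-constant IH L (s≤s⁻¹ w<A) (trans (halve L w false {t} w/L) (sym (halve L (suc a) true A/L)))
      fa≡Y : f a /2^ L ≡ Y /2^ L
      fa≡Y = subst (λ i → f a /2^ i ≡ Y /2^ i) (sym (+-suc k j))
               (/2^-lift (suc k) j (trans (halve k (f a) false {s} fa/) (sym (halve k Y true Y/))))

    module Even (IH : NoJumpBelow a) (∤A : ¬ 2 ^ suc k ∣ suc a) (h : ℕ) (A/ : suc a /2^ k ≡ h * 2) where

      u : ℕ
      u = (Y ⊕ suc a) /2^ k * 2 ^ k

      u/ : u /2^ k ≡ (Y ⊕ suc a) /2^ k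
      u/ = m*n/n≡m ((Y ⊕ suc a) /2^ k) (2 ^ k)

      A%≢0 : suc a %2^ k ≢ 0
      A%≢0 A%≡0 = ∤A (divides h (begin
        suc a                                ≡⟨ m≡m%n+[m/n]*n (suc a) (2 ^ k) ⟩
        suc a %2^ k + suc a /2^ k * 2 ^ k    ≡⟨ cong₂ (λ r q → r + q * 2 ^ k) A%≡0 A/ ⟩
        h * 2 * 2 ^ k                        ≡⟨ *-assoc h 2 (2 ^ k) ⟩
        h * 2 ^ suc k                        ∎))
        where open ≡-Reasoning

      u<YA : u < Y ⊕ suc a
      u<YA = begin-strict
        u                          <⟨ m<n+m u (n≢0⇒n>0 A%≢0) ⟩
        suc a %2^ k + u            ≡⟨ cong (_+ u) YA% ⟨
        (Y ⊕ suc a) %2^ k + u      ≡⟨ m≡m%n+[m/n]*n (Y ⊕ suc a) (2 ^ k) ⟨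
        Y ⊕ suc a                  ∎
        where open ≤-Reasoning

      Y≤u⊕A : Y ≤ u ⊕ suc a
      Y≤u⊕A = begin
        Y                           ≡⟨ cong (_* 2 ^ k) uA/ ⟨
        (u ⊕ suc a) /2^ k * 2 ^ k   ≤⟨ m/n*n≤m (u ⊕ suc a) (2 ^ k) ⟩
        u ⊕ suc a                   ∎
        where
        open ≤-Reasoning
        uA/ : (u ⊕ suc a) /2^ k ≡ 1 + s * 2
        uA/ = begin-equality
          (u ⊕ suc a) /2^ k                        ≡⟨ /2^-⊕ k u (suc a) ⟩
          u /2^ k ⊕ suc a /2^ k                    ≡⟨ cong (_⊕ suc a /2^ k) (trans u/ YA/) ⟩
          (1 + s * 2) ⊕ suc a /2^ k ⊕ suc a /2^ k  ≡⟨ ⊕-cancelʳ (1 + s * 2) (suc a /2^ k) ⟩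
          1 + s * 2                                ∎

      unreachable : ∀ {w} → w < suc a → u ≡ f w ⊕ w → ⊥
      unreachable {w} w<A u≡ with w /2^ k ≟ suc a /2^ k
      ... | yes same = 1+n≰n (subst (_≤ s * 2) fw/ (subst (f w /2^ k ≤_) fa/ (/-monoˡ-≤ (2 ^ k) (f-mono (s≤s⁻¹ w<A)))))
        where
        fw/ : f w /2^ k ≡ 1 + s * 2
        fw/ = ⊕-injectiveˡ (suc a /2^ k) (begin
          f w /2^ k ⊕ suc a /2^ k   ≡⟨ cong (f w /2^ k ⊕_) same ⟨
          f w /2^ k ⊕ w /2^ k       ≡⟨ /2^-⊕ k (f w) w ⟨
          (f w ⊕ w) /2^ k           ≡⟨ cong (_/2^ k) u≡ ⟨
          u /2^ k                   ≡⟨ trans u/ YA/ ⟩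
          (1 + s * 2) ⊕ suc a /2^ k ∎)
          where open ≡-Reasoning
      ... | no differ with highest-differing-bit (≤∧≢⇒< (/-monoˡ-≤ (2 ^ k) (<⇒≤ w<A)) differ)
      ...   | zero  , t , _ , A/0 = m*2≢1+n*2 h t (trans (sym A/) (trans (sym (n/1≡n _)) A/0))
      ...   | suc j , t , w/j , A/j = differing-level-impossible IH w<A j t
                (trans (/2^-+ w k (suc j)) w/j) (trans (/2^-+ (suc a) k (suc j)) A/j)
                (trans (cong (_/2^ k) (sym u≡)) u/)

      impossible : ⊥
      impossible with w , w<A , u≡ ← full-column-value-below f grundy-⊕ Y≤fA (λ w<A → <⇒≤ (f<Y w<A)) u<YA Y≤u⊕A =
        unreachable w<A u≡

  jump-impossible : ∀ {a} → NoJumpBelow a → ∀ k s → f a /2^ k ≡ s * 2 → f (suc a) /2^ k ≡ 1 + s * 2 →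
                    ¬ 2 ^ suc k ∣ suc a → ⊥
  jump-impossible {a} IH k s fa/ fA/ ∤A with even-or-odd (suc a /2^ k)
  ... | inj₁ (h , A/) = Jump.Even.impossible a k s fa/ fA/ IH ∤A h A/
  ... | inj₂ (h , A/) = Jump.Odd.impossible a k s fa/ fA/ h A/

  no-jump-step : ∀ a → NoJumpBelow a → NoJumpAt a
  no-jump-step a IH ℓ ∤A = ≮⇒≥ λ jump → case highest-differing-bit jump of λ where
    (j , s , fa/ , fA/) → jump-impossible IH (ℓ + j) s (trans (/2^-+ (f a) ℓ j) fa/) (trans (/2^-+ (f (suc a)) ℓ j) fA/)
                            (λ ∣A → ∤A (∣-trans (2^-∣-mono (s≤s (m≤m+n ℓ j))) ∣A))

  no-jump : ∀ b → NoJumpAt b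
  no-jump = <-rec NoJumpAt no-jump-step

  no-jump-below-multiple : ∀ {a m} i → ¬ 2 ^ suc i ∣ suc a → f a < m * 2 ^ i → f (suc a) < m * 2 ^ i
  no-jump-below-multiple {a} {m} i ∤A fa< = begin-strict
    f (suc a)                       <⟨ m<[1+m/n]*n (f (suc a)) (2 ^ i) ⟩
    suc (f (suc a) /2^ i) * 2 ^ i   ≤⟨ *-monoˡ-≤ (2 ^ i) (≤-<-trans (no-jump a i ∤A) (m<n*o⇒m/o<n {n = m} fa<)) ⟩
    m * 2 ^ i                       ∎
    where
    open ≤-Reasoning
    instance _ = m^n≢0 2 i

[1+c*2]*2^i≡c*2^[i+1]+2^i : ∀ c i → (1 + c * 2) * 2 ^ i ≡ c * 2 ^ (i + 1) + 2 ^ i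
[1+c*2]*2^i≡c*2^[i+1]+2^i c i = trans (expand c (2 ^ i)) (cong (λ p → c * p + 2 ^ i) (sym (^-distribˡ-+-* 2 i 1)))
  where
  expand : ∀ c p → (1 + c * 2) * p ≡ c * (p * 2) + p
  expand = solve-∀

¬2^[1+i]∣d*2^[i+1]+dᵢ*2^i+e : ∀ {d dᵢ e} i → dᵢ ≤ 1 → e < 2 ^ i → 0 < dᵢ * 2 ^ i + e →
                              ¬ 2 ^ suc i ∣ d * 2 ^ (i + 1) + dᵢ * 2 ^ i + e
¬2^[1+i]∣d*2^[i+1]+dᵢ*2^i+e {d} {dᵢ} {e} i dᵢ≤1 e<2^i 0<r =
  subst (λ n → ¬ 2 ^ suc i ∣ n) (sym regroup) (¬∣-nonzero-remainder d 0<r r<2^[1+i])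
  where
  r<2^[1+i] : dᵢ * 2 ^ i + e < 2 ^ suc i
  r<2^[1+i] = begin-strict
    dᵢ * 2 ^ i + e        <⟨ +-monoʳ-< (dᵢ * 2 ^ i) e<2^i ⟩
    dᵢ * 2 ^ i + 2 ^ i    ≤⟨ +-monoˡ-≤ (2 ^ i) (*-monoˡ-≤ (2 ^ i) dᵢ≤1) ⟩
    1 * 2 ^ i + 2 ^ i     ≡⟨ cong (_+ 2 ^ i) (*-identityˡ (2 ^ i)) ⟩
    2 ^ i + 2 ^ i         ≡⟨ cong (2 ^ i +_) (+-identityʳ (2 ^ i)) ⟨
    2 ^ suc i             ∎
    where open ≤-Reasoning
  regroup : d * 2 ^ (i + 1) + dᵢ * 2 ^ i + e ≡ d * 2 ^ suc i + (dᵢ * 2 ^ i + e)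
  regroup = trans (+-assoc (d * 2 ^ (i + 1)) (dᵢ * 2 ^ i) e) (cong (λ p → d * 2 ^ p + (dᵢ * 2 ^ i + e)) (+-comm i 1))

mainTheorem14 :
    (f : ℕ → ℕ) →
    (∀ {m n} → m ≤ n → f m ≤ f n) →
    (∀ y z → y ≤ f z → grundy f y z ≡ y ⊕ z) →
    (a d e i dᵢ c : ℕ) →
    dᵢ ≤ 1 →
    e < 2 ^ i →
    0 < dᵢ * 2 ^ i + e →
    a ≡ d * 2 ^ (i + 1) + dᵢ * 2 ^ i + e ∸ 1 →
    c * 2 ^ (i + 1) ≤ f a →
    f a < c * 2 ^ (i + 1) + 2 ^ i →
    f (a + 1) < c * 2 ^ (i + 1) + 2 ^ i
mainTheorem14 f f-mono grundy-⊕ a d e i dᵢ c dᵢ≤1 e<2^i 0<r a≡ _ fa< =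
  subst₂ _<_ (cong f (+-comm 1 a)) bound≡
    (no-jump-below-multiple f f-mono grundy-⊕ {m = 1 + c * 2} i ∤1+a (subst (f a <_) (sym bound≡) fa<))
  where
  bound≡ : (1 + c * 2) * 2 ^ i ≡ c * 2 ^ (i + 1) + 2 ^ i
  bound≡ = [1+c*2]*2^i≡c*2^[i+1]+2^i c i
  1+a≡ : suc a ≡ d * 2 ^ (i + 1) + dᵢ * 2 ^ i + e
  1+a≡ = trans (cong suc a≡) (m+[n∸m]≡n (<-≤-trans 0<r (+-monoˡ-≤ e (m≤n+m (dᵢ * 2 ^ i) (d * 2 ^ (i + 1))))))
  ∤1+a : ¬ 2 ^ suc i ∣ suc a
  ∤1+a = subst (λ n → ¬ 2 ^ suc i ∣ n) (sym 1+a≡) (¬2^[1+i]∣d*2^[i+1]+dᵢ*2^i+e {d} i dᵢ≤1 e<2^i 0<r)
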